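{- Let $G$ be a finite, simple, connected, undirected graph. If $G$ is not a sputnik and every maximal independent set of $G$ is robust, then $G$ is a complete bipartite graph.
   Context: A connected spanning subgraph of $G=(V,E_G)$ is a connected graph $H=(V,E_H)$ with $E_H\subseteq E_G$. A maximal independent set (MIS) is a set of pairwise non-adjacent vertices maximal for inclusion. An MIS $S$ of $G$ is robust if $S$ is a maximal independent set in every connected spanning subgraph of $G$ (including $G$ itself). A vertex is pendant if it has degree $1$. A graph is a sputnik if every vertex that belongs to a cycle has at least one pendant neighbor. A complete bipartite graph is a graph whose vertex set is partitioned into two disjoint sets $V_1,V_2$ such that the edge set is exactly $\{\{v_1,v_2\}: v_1\in V_1, v_2\in V_2\}$. -}

module Defs where

open import Data.Bool using (Bool; true; false; if_then_else_)
open import Data.Nat using (ℕ; _≥_)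
open import Data.Fin using (Fin)
open import Data.List using (List; []; _∷_; length; map; allFin)
open import Data.Nat.ListAction using (sum)
open import Data.Unit using (⊤)
open import Data.Empty using (⊥)
open import Data.List.Membership.Propositional using (_∈_)
open import Data.List.Relation.Unary.Unique.Propositional using (Unique)
open import Data.Product using (Σ; ∃; _×_)
open import Relation.Nullary using (¬_)
open import Relation.Binary.PropositionalEquality using (_≡_; _≢_)
open import Function.Bundles using (_⇔_)

record SimpleGraph (n : ℕ) : Set where
  field
    adj    : Fin n → Fin n → Bool
    sym    : ∀ u v → adj u v ≡ adj v u
    irrefl : ∀ v → adj v v ≡ false
open SimpleGraph public

Edge : ∀ {n} → SimpleGraph n → Fin n → Fin n → Set
Edge G u v = adj G u v ≡ true

data Reach {n} (G : SimpleGraph n) : Fin n → Fin n → Set where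
  here : ∀ {v} → Reach G v v
  step : ∀ {u w v} → Edge G u w → Reach G w v → Reach G u v

Connected : ∀ {n} → SimpleGraph n → Set
Connected G = ∀ u v → Reach G u v

SpanningSubgraph : ∀ {n} → SimpleGraph n → SimpleGraph n → Set
SpanningSubgraph H G = ∀ u v → Edge H u v → Edge G u v

VSet : ℕ → Set
VSet n = Fin n → Bool

_∈ₛ_ : ∀ {n} → Fin n → VSet n → Set
v ∈ₛ S = S v ≡ true

_⊆ₛ_ : ∀ {n} → VSet n → VSet n → Set
S ⊆ₛ T = ∀ v → v ∈ₛ S → v ∈ₛ T

Independent : ∀ {n} → SimpleGraph n → VSet n → Set
Independent G S = ∀ u v → u ∈ₛ S → v ∈ₛ S → ¬ Edge G u v

MIS : ∀ {n} → SimpleGraph n → VSet n → Set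
MIS G S = Independent G S × (∀ T → Independent G T → S ⊆ₛ T → T ⊆ₛ S)

Robust : ∀ {n} → SimpleGraph n → VSet n → Set
Robust G S = MIS G S ×
  (∀ (H : SimpleGraph _) → SpanningSubgraph H G → Connected H → MIS H S)

degree : ∀ {n} → SimpleGraph n → Fin n → ℕ
degree {n} G v = sum (map (λ u → if adj G v u then 1 else 0) (allFin n))

Pendant : ∀ {n} → SimpleGraph n → Fin n → Set
Pendant G v = degree G v ≡ 1

ClosedWalkFrom : ∀ {n} → SimpleGraph n → Fin n → List (Fin n) → Set
ClosedWalkFrom G first [] = ⊤
ClosedWalkFrom G first (x ∷ []) = Edge G x first
ClosedWalkFrom G first (x ∷ y ∷ xs) = Edge G x y × ClosedWalkFrom G first (y ∷ xs)

IsCycle : ∀ {n} → SimpleGraph n → List (Fin n) → Set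
IsCycle G [] = ⊥
IsCycle G (x ∷ xs) = length (x ∷ xs) ≥ 3 × Unique (x ∷ xs) × ClosedWalkFrom G x (x ∷ xs)

OnCycle : ∀ {n} → SimpleGraph n → Fin n → Set
OnCycle G v = ∃ λ c → IsCycle G c × v ∈ c

Sputnik : ∀ {n} → SimpleGraph n → Set
Sputnik G = ∀ v → OnCycle G v → ∃ λ u → Edge G v u × Pendant G u

CompleteBipartite : ∀ {n} → SimpleGraph n → Set
CompleteBipartite {n} G = Σ (VSet n) λ p → ∀ u v → Edge G u v ⇔ (p u ≢ p v)

-- If S is an MIS with x ∉ S and every edge from x into S can be
-- rerouted, by a walk avoiding x, to a neighbour of x outside S, then deleting
-- the edges between x and S keeps G connected while S ∪ {x} becomes
-- independent, so S is not robust.  When x has no pendant neighbour such an S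
-- can be grown greedily from a small seed containing a neighbour of x.  Hence,
-- if every MIS is robust, no two neighbours of x are adjacent, and two
-- neighbours of x joined by a walk avoiding x have the same neighbours other
-- than x.  If x also lies on a cycle, this propagates along edges: every vertex
-- is a neighbour of x or has exactly the neighbours of x, so G is complete
-- bipartite with parts N(x) and V ∖ N(x).  A graph that is not a sputnik has a
-- vertex on a cycle without pendant neighbour.

module Submission where

open import Defs
open import Data.Bool using (Bool; true; false; if_then_else_; _∧_; _∨_; not)
open import Data.Bool.Properties using (∨-comm; ∧-conicalˡ; ∧-conicalʳ; ¬-not; ⇔→≡)
  renaming (_≟_ to _≟ᵇ_)
open import Data.Empty using (⊥; ⊥-elim)
open import Data.Fin using (Fin; zero; suc; _≟_)
open import Data.Fin.Properties using (any?; all?; suc-injective)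
open import Data.List using (List; []; _∷_; _++_; length; allFin; tabulate)
open import Data.List.Properties using (++-assoc; length-++-comm; map-tabulate)
open import Data.List.Membership.Propositional using (_∈_)
open import Data.List.Membership.Propositional.Properties using (∈-∃++; ∈-allFin)
open import Data.List.Relation.Unary.All using (All; []; _∷_)
import Data.List.Relation.Unary.All as All
open import Data.List.Relation.Unary.AllPairs using ([]; _∷_)
import Data.List.Relation.Unary.AllPairs.Properties as AllPairs
open import Data.List.Relation.Unary.Any using (here; there)
open import Data.List.Relation.Unary.Unique.Propositional using (Unique)
open import Data.Nat using (ℕ; _≤_; s≤s)
import Data.Nat as ℕ
open import Data.Nat.ListAction using (sum)
open import Data.Nat.Properties using (≤-trans; ≤-reflexive)
open import Data.Product using (Σ; ∃; ∃₂; _×_; _,_; proj₂; uncurry)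
open import Data.Sum using (_⊎_; inj₁; inj₂)
open import Data.Unit using (⊤; tt)
open import Function using (case_of_)
open import Function.Bundles using (_⇔_; mk⇔; Equivalence)
open import Relation.Nullary using (¬_; Dec; yes; no; does; ¬?)
open import Relation.Nullary.Decidable
  using (_×-dec_; _⊎-dec_; _→-dec_; map′; dec-true; dec-false; decidable-stable)
open import Relation.Binary.PropositionalEquality
  using (_≡_; _≢_; refl; trans; cong; cong₂; subst; ≢-sym)
import Relation.Binary.PropositionalEquality as ≡

false≢true : false ≢ true
false≢true ()

≡true⇔false≢ : ∀ {b} → (b ≡ true) ⇔ (false ≢ b)
≡true⇔false≢ {true}  = mk⇔ (λ _ ()) (λ _ → refl)
≡true⇔false≢ {false} = mk⇔ (λ ()) (λ false≢false → ⊥-elim (false≢false refl))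

_⇔-dec_ : ∀ {A B : Set} → Dec A → Dec B → Dec (A ⇔ B)
A? ⇔-dec B? = map′ (uncurry mk⇔) (λ A⇔B → Equivalence.to A⇔B , Equivalence.from A⇔B)
                   ((A? →-dec B?) ×-dec (B? →-dec A?))

Unique-rotate₁ : ∀ {A : Set} {y : A} (t : List A) → Unique (y ∷ t) → Unique (t ++ y ∷ [])
Unique-rotate₁ t (y∉t ∷ uniq) =
  AllPairs.++⁺ uniq ([] ∷ []) (All.map (λ y≢v → ≢-sym y≢v ∷ []) y∉t)

sum-tabulate-≡0 : ∀ {m} (h : Fin m → ℕ) → (∀ w → h w ≡ 0) → sum (tabulate h) ≡ 0
sum-tabulate-≡0 {ℕ.zero}  h h≡0 = refl
sum-tabulate-≡0 {ℕ.suc m} h h≡0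
  rewrite h≡0 zero = sum-tabulate-≡0 (λ w → h (suc w)) (λ w → h≡0 (suc w))

sum-tabulate-≡1 : ∀ {m} (h : Fin m → ℕ) c → h c ≡ 1 → (∀ w → w ≢ c → h w ≡ 0) →
                  sum (tabulate h) ≡ 1
sum-tabulate-≡1 h zero hc≡1 h≡0 rewrite hc≡1 =
  cong ℕ.suc (sum-tabulate-≡0 (λ w → h (suc w)) (λ w → h≡0 (suc w) (λ ())))
sum-tabulate-≡1 h (suc c) hc≡1 h≡0 rewrite h≡0 zero (λ ()) =
  sum-tabulate-≡1 (λ w → h (suc w)) c hc≡1
                  (λ w w≢c → h≡0 (suc w) (λ eq → w≢c (suc-injective eq)))

module Graph {n : ℕ} (G : SimpleGraph n) where

  Edge-sym : ∀ {u v} → Edge G u v → Edge G v u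
  Edge-sym {u} {v} u~v = trans (sym G v u) u~v

  Edge⇒≢ : ∀ {u v} → Edge G u v → u ≢ v
  Edge⇒≢ {u} u~u refl = false≢true (trans (≡.sym (irrefl G u)) u~u)

  Reach-trans : ∀ {u v w} → Reach G u v → Reach G v w → Reach G u w
  Reach-trans here         r = r
  Reach-trans (step e r₁) r₂ = step e (Reach-trans r₁ r₂)

  Reach-sym : ∀ {u v} → Reach G u v → Reach G v u
  Reach-sym here       = here
  Reach-sym (step e r) = Reach-trans (Reach-sym r) (step (Edge-sym e) here)

  Reach-preserves : ∀ {P : Fin n → Set} → (∀ {u v} → P u → Edge G u v → P v) →
                    ∀ {u v} → Reach G u v → P u → P v
  Reach-preserves P-step here       Pu = Pu
  Reach-preserves P-step (step e r) Pu = Reach-preserves P-step r (P-step Pu e)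

  edge? : ∀ u v → Dec (Edge G u v)
  edge? u v = adj G u v ≟ᵇ true

data ReachAvoiding {n} (G : SimpleGraph n) (x : Fin n) : Fin n → Fin n → Set where
  here : ∀ {v} → ReachAvoiding G x v v
  step : ∀ {u w v} → Edge G u w → u ≢ x → w ≢ x → ReachAvoiding G x w v →
         ReachAvoiding G x u v

module _ {n : ℕ} {G : SimpleGraph n} {x : Fin n} where

  open Graph G

  ReachAvoiding-trans : ∀ {u v w} → ReachAvoiding G x u v → ReachAvoiding G x v w →
                        ReachAvoiding G x u w
  ReachAvoiding-trans here                 r = r
  ReachAvoiding-trans (step e u≢x w≢x r₁) r₂ = step e u≢x w≢x (ReachAvoiding-trans r₁ r₂)

  ReachAvoiding-sym : ∀ {u v} → ReachAvoiding G x u v → ReachAvoiding G x v u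
  ReachAvoiding-sym here                = here
  ReachAvoiding-sym (step e u≢x w≢x r) =
    ReachAvoiding-trans (ReachAvoiding-sym r) (step (Edge-sym e) w≢x u≢x here)

module _ {n : ℕ} where

  ⊆ₛ-refl : ∀ {S : VSet n} → S ⊆ₛ S
  ⊆ₛ-refl v v∈S = v∈S

  ⊆ₛ-trans : ∀ {S T U : VSet n} → S ⊆ₛ T → T ⊆ₛ U → S ⊆ₛ U
  ⊆ₛ-trans S⊆T T⊆U v v∈S = T⊆U v (S⊆T v v∈S)

  insert : VSet n → Fin n → VSet n
  insert S z v = if does (v ≟ z) then true else S v

  ∈-insert⁻ : ∀ {S z v} → v ∈ₛ insert S z → v ≡ z ⊎ v ∈ₛ S
  ∈-insert⁻ {S = S} {z} {v} v∈ with v ≟ z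
  ... | yes v≡z = inj₁ v≡z
  ... | no  _   = inj₂ v∈

  insert-self : ∀ S z → z ∈ₛ insert S z
  insert-self S z rewrite dec-true (z ≟ z) refl = refl

  ⊆-insert : ∀ S z → S ⊆ₛ insert S z
  ⊆-insert S z v v∈S with v ≟ z
  ... | yes _ = refl
  ... | no  _ = v∈S

  singleton : Fin n → VSet n
  singleton = insert (λ _ → false)

  ∈-singleton⁻ : ∀ {y v} → v ∈ₛ singleton y → v ≡ y
  ∈-singleton⁻ v∈ with ∈-insert⁻ v∈
  ... | inj₁ v≡y = v≡y

module _ {n : ℕ} (G : SimpleGraph n) where

  open Graph G

  Dominated : VSet n → Fin n → Set
  Dominated S v = v ∈ₛ S ⊎ ∃ λ t → t ∈ₛ S × Edge G v t

  dominated? : ∀ S v → Dec (Dominated S v)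
  dominated? S v = (S v ≟ᵇ true) ⊎-dec any? (λ t → (S t ≟ᵇ true) ×-dec edge? v t)

  Dominated-mono : ∀ {S T v} → S ⊆ₛ T → Dominated S v → Dominated T v
  Dominated-mono S⊆T (inj₁ v∈S)            = inj₁ (S⊆T _ v∈S)
  Dominated-mono S⊆T (inj₂ (t , t∈S , v~t)) = inj₂ (t , S⊆T t t∈S , v~t)

  ∉-by-neighbour : ∀ {S t u} → Independent G S → t ∈ₛ S → Edge G u t → S u ≡ false
  ∉-by-neighbour {u = u} indep t∈S u~t = ¬-not (λ u∈S → indep u _ u∈S t∈S u~t)

  insert-independent : ∀ {S z} → Independent G S → ¬ Dominated S z →
                       Independent G (insert S z)
  insert-independent {S} {z} indep ¬dom u v u∈ v∈ u~v
    with ∈-insert⁻ {S = S} u∈ | ∈-insert⁻ {S = S} v∈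
  ... | inj₁ refl | inj₁ refl = Edge⇒≢ u~v refl
  ... | inj₁ refl | inj₂ v∈S  = ¬dom (inj₂ (v , v∈S , u~v))
  ... | inj₂ u∈S  | inj₁ refl = ¬dom (inj₂ (u , u∈S , Edge-sym u~v))
  ... | inj₂ u∈S  | inj₂ v∈S  = indep u v u∈S v∈S u~v

  singleton-independent : ∀ y → Independent G (singleton y)
  singleton-independent y = insert-independent (λ _ _ ()) λ { (inj₁ ()) ; (inj₂ (_ , () , _)) }

  dominate : (vs : List (Fin n)) → ∀ {S} → Independent G S →
             Σ (VSet n) λ T → Independent G T × S ⊆ₛ T × (∀ {v} → v ∈ vs → Dominated T v)
  dominate []       {S} indep = S , indep , ⊆ₛ-refl , λ ()
  dominate (u ∷ vs) {S} indep with dominated? S u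
  ... | yes dom with T , indepT , S⊆T , domT ← dominate vs indep =
    T , indepT , S⊆T , λ { (here refl) → Dominated-mono S⊆T dom ; (there v∈) → domT v∈ }
  ... | no ¬dom with T , indepT , S⊆T , domT ← dominate vs (insert-independent indep ¬dom) =
    T , indepT , ⊆ₛ-trans (⊆-insert S u) S⊆T ,
    λ { (here refl) → inj₁ (S⊆T u (insert-self S u)) ; (there v∈) → domT v∈ }

  dominating⇒MIS : ∀ {S} → Independent G S → (∀ v → Dominated S v) → MIS G S
  dominating⇒MIS {S} indep dom = indep , maximal
    where
    maximal : ∀ T → Independent G T → S ⊆ₛ T → T ⊆ₛ S
    maximal T indepT S⊆T v v∈T with dom v
    ... | inj₁ v∈S              = v∈S
    ... | inj₂ (t , t∈S , v~t) = ⊥-elim (indepT v t v∈T (S⊆T t t∈S) v~t)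

  extend-to-MIS : ∀ {S} → Independent G S → Σ (VSet n) λ T → MIS G T × S ⊆ₛ T
  extend-to-MIS indep with T , indepT , S⊆T , domT ← dominate (allFin n) indep =
    T , dominating⇒MIS indepT (λ v → domT (∈-allFin v)) , S⊆T

module DeleteEdges {n : ℕ} (G : SimpleGraph n) (S : VSet n) (x : Fin n) where

  open Graph G

  betweenXandS : Fin n → Fin n → Bool
  betweenXandS u v = (does (u ≟ x) ∧ S v) ∨ (does (v ≟ x) ∧ S u)

  G∖xS : SimpleGraph n
  G∖xS = record
    { adj    = λ u v → adj G u v ∧ not (betweenXandS u v)
    ; sym    = λ u v → cong₂ _∧_ (sym G u v)
                         (cong not (∨-comm (does (u ≟ x) ∧ S v) (does (v ≟ x) ∧ S u)))
    ; irrefl = λ v → cong (_∧ not (betweenXandS v v)) (irrefl G v)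
    }

  G∖xS-spanning : SpanningSubgraph G∖xS G
  G∖xS-spanning u v u~v = ∧-conicalˡ _ _ u~v

  G∖xS-keeps-avoiding : ∀ {u v} → Edge G u v → u ≢ x → v ≢ x → Edge G∖xS u v
  G∖xS-keeps-avoiding {u} {v} u~v u≢x v≢x
    rewrite u~v | dec-false (u ≟ x) u≢x | dec-false (v ≟ x) v≢x = refl

  G∖xS-keeps-outside : ∀ {u} → Edge G x u → S u ≡ false → Edge G∖xS x u
  G∖xS-keeps-outside {u} x~u u∉S
    rewrite x~u | u∉S | dec-true (x ≟ x) refl | dec-false (u ≟ x) (≢-sym (Edge⇒≢ x~u)) = refl

  G∖xS-cuts : ∀ {s} → s ∈ₛ S → ¬ Edge G∖xS x s
  G∖xS-cuts {s} s∈S x~s =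
    false≢true (∧-conicalʳ _ _ (subst (λ b → adj G x s ∧ not b ≡ true) between x~s))
    where
    between : betweenXandS x s ≡ true
    between rewrite dec-true (x ≟ x) refl | s∈S = refl

  insert-x-independent : Independent G S → Independent G∖xS (insert S x)
  insert-x-independent indep u v u∈ v∈ u~v
    with ∈-insert⁻ {S = S} u∈ | ∈-insert⁻ {S = S} v∈
  ... | inj₁ refl | inj₁ refl = Graph.Edge⇒≢ G∖xS u~v refl
  ... | inj₁ refl | inj₂ v∈S  = G∖xS-cuts v∈S u~v
  ... | inj₂ u∈S  | inj₁ refl = G∖xS-cuts u∈S (Graph.Edge-sym G∖xS u~v)
  ... | inj₂ u∈S  | inj₂ v∈S  = indep u v u∈S v∈S (G∖xS-spanning u v u~v)

  ReachAvoiding⇒Reach : ∀ {u v} → ReachAvoiding G x u v → Reach G∖xS u v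
  ReachAvoiding⇒Reach here                 = here
  ReachAvoiding⇒Reach (step e u≢x w≢x r) =
    step (G∖xS-keeps-avoiding e u≢x w≢x) (ReachAvoiding⇒Reach r)

  EdgesReroutable : Set
  EdgesReroutable = ∀ {u} → Edge G x u → u ∈ₛ S →
                    ∃ λ u' → Edge G x u' × ReachAvoiding G x u u' × S u' ≡ false

  G∖xS-connected : Connected G → EdgesReroutable → Connected G∖xS
  G∖xS-connected connected reroute u v = reach (connected u v)
    where
    from-x : ∀ {u} → Edge G x u → Reach G∖xS x u
    from-x {u} x~u with S u in eq
    ... | false = step (G∖xS-keeps-outside x~u eq) here
    ... | true with u' , x~u' , u⇝u' , u'∉S ← reroute x~u eq =
      step (G∖xS-keeps-outside x~u' u'∉S) (Graph.Reach-sym G∖xS (ReachAvoiding⇒Reach u⇝u'))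
    edge : ∀ {u v} → Edge G u v → Reach G∖xS u v
    edge {u} {v} u~v with u ≟ x | v ≟ x
    ... | yes refl | yes refl = ⊥-elim (Edge⇒≢ u~v refl)
    ... | yes refl | no _     = from-x u~v
    ... | no _     | yes refl = Graph.Reach-sym G∖xS (from-x (Edge-sym u~v))
    ... | no u≢x   | no v≢x   = step (G∖xS-keeps-avoiding u~v u≢x v≢x) here
    reach : ∀ {u v} → Reach G u v → Reach G∖xS u v
    reach here       = here
    reach (step e r) = Graph.Reach-trans G∖xS (edge e) (reach r)

¬Robust-by-rerouting : ∀ {n} {G : SimpleGraph n} {S x} → Connected G → MIS G S →
                       S x ≡ false → DeleteEdges.EdgesReroutable G S x → ¬ Robust G S
¬Robust-by-rerouting {G = G} {S} {x} connected (indep , _) x∉S reroute (_ , robustIn) =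
  false≢true (trans (≡.sym x∉S) x∈S)
  where
  open DeleteEdges G S x
  x∈S : x ∈ₛ S
  x∈S = proj₂ (robustIn G∖xS G∖xS-spanning (G∖xS-connected connected reroute))
              (insert S x) (insert-x-independent indep) (⊆-insert S x) x (insert-self S x)

NoPendantNeighbour : ∀ {n} → SimpleGraph n → Fin n → Set
NoPendantNeighbour G x = ∀ u → Edge G x u → ∃ λ z → Edge G u z × z ≢ x

module Greedy {n : ℕ} (G : SimpleGraph n) {x y : Fin n} (x~y : Edge G x y) where

  open Graph G

  -- u' is adjacent to I, so no MIS containing I contains u'; an edge from x to u
  -- can then be replaced by the edge from x to u' followed by the walk.
  Reroutable : VSet n → Fin n → Set
  Reroutable I u =
    ∃ λ u' → Edge G x u' × ReachAvoiding G x u u' × ∃ λ t → t ∈ₛ I × Edge G u' t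

  Reroutable-mono : ∀ {I J u} → I ⊆ₛ J → Reroutable I u → Reroutable J u
  Reroutable-mono I⊆J (u' , x~u' , u⇝u' , t , t∈I , u'~t) =
    u' , x~u' , u⇝u' , t , I⊆J t t∈I , u'~t

  -- y ∈ I keeps x out of every MIS containing I; asking the members of I to be
  -- reroutable lets a neighbour of x be rerouted through any vertex dominated by I.
  record Seed (I : VSet n) : Set where
    field
      independent : Independent G I
      y∈I         : y ∈ₛ I
      reroutable  : ∀ {t} → t ∈ₛ I → Reroutable I t

  open Seed

  Seed⇒≢x : ∀ {I t} → Seed I → t ∈ₛ I → t ≢ x
  Seed⇒≢x seed t∈I refl = independent seed _ y t∈I (y∈I seed) x~y

  module _ (noPendant : NoPendantNeighbour G x) where

    dominated⇒reroutable : ∀ {I u z} → Seed I → Edge G x u → Edge G u z → z ≢ x →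
                           Dominated G I z → Reroutable I u
    dominated⇒reroutable seed x~u u~z z≢x (inj₁ z∈I) = _ , x~u , here , _ , z∈I , u~z
    dominated⇒reroutable seed x~u u~z z≢x (inj₂ (t , t∈I , z~t))
      with u' , x~u' , t⇝u' , rest ← reroutable seed t∈I =
      u' , x~u' , step u~z (≢-sym (Edge⇒≢ x~u)) z≢x (step z~t z≢x (Seed⇒≢x seed t∈I) t⇝u') ,
      rest

    insert-seed : ∀ {I u z} → Seed I → Edge G x u → Edge G u z → z ≢ x →
                  ¬ Dominated G I z → Seed (insert I z)
    insert-seed {I} {u} {z} seed x~u u~z z≢x ¬dom = record
      { independent = insert-independent G (independent seed) ¬dom
      ; y∈I         = ⊆-insert I z y (y∈I seed)
      ; reroutable  = reroutable′
      }
      where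
      reroutable′ : ∀ {t} → t ∈ₛ insert I z → Reroutable (insert I z) t
      reroutable′ t∈ with ∈-insert⁻ {S = I} t∈
      ... | inj₁ refl =
        u , x~u , step (Edge-sym u~z) z≢x (≢-sym (Edge⇒≢ x~u)) here , z , insert-self I z , u~z
      ... | inj₂ t∈I = Reroutable-mono (⊆-insert I z) (reroutable seed t∈I)

    grow : ∀ {I u} → Seed I → Edge G x u →
           Σ (VSet n) λ J → Seed J × I ⊆ₛ J × Reroutable J u
    grow {I} {u} seed x~u with z , u~z , z≢x ← noPendant u x~u | dominated? G I z
    ... | yes dom  = I , seed , ⊆ₛ-refl , dominated⇒reroutable seed x~u u~z z≢x dom
    ... | no  ¬dom = insert I z , insert-seed seed x~u u~z z≢x ¬dom , ⊆-insert I z ,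
                     (u , x~u , here , z , insert-self I z , u~z)

    grow-all : (vs : List (Fin n)) → ∀ {I} → Seed I →
               Σ (VSet n) λ J → Seed J × I ⊆ₛ J ×
                                (∀ {u} → u ∈ vs → Edge G x u → Reroutable J u)
    grow-all []       {I} seed = I , seed , ⊆ₛ-refl , λ ()
    grow-all (v ∷ vs) seed with edge? x v
    ... | no x≁v with J , seedJ , I⊆J , r ← grow-all vs seed =
      J , seedJ , I⊆J , λ { (here refl) x~v → ⊥-elim (x≁v x~v) ; (there u∈) → r u∈ }
    ... | yes x~v with J₁ , seed₁ , I⊆J₁ , rv ← grow seed x~v
                  with J , seedJ , J₁⊆J , r ← grow-all vs seed₁ =
      J , seedJ , ⊆ₛ-trans I⊆J₁ J₁⊆J ,
      λ { (here refl) _ → Reroutable-mono J₁⊆J rv ; (there u∈) → r u∈ }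

    seed⇒nonRobustMIS : ∀ {I} → Connected G → Seed I →
                        Σ (VSet n) λ S → MIS G S × ¬ Robust G S
    seed⇒nonRobustMIS connected seed with J , seedJ , _ , r ← grow-all (allFin n) seed
      with S , (indep , maximal) , J⊆S ← extend-to-MIS G (independent seedJ) =
      S , (indep , maximal) , ¬Robust-by-rerouting connected (indep , maximal) x∉S reroute
      where
      x∉S : S x ≡ false
      x∉S = ∉-by-neighbour G indep (J⊆S y (y∈I seedJ)) x~y
      reroute : DeleteEdges.EdgesReroutable G S x
      reroute x~u _ with u' , x~u' , u⇝u' , t , t∈J , u'~t ← r (∈-allFin _) x~u =
        u' , x~u' , u⇝u' , ∉-by-neighbour G indep (J⊆S t t∈J) u'~t

module Cycles {n : ℕ} (G : SimpleGraph n) where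

  WalkFrom : Fin n → List (Fin n) → Set
  WalkFrom a []       = ⊤
  WalkFrom a (v ∷ vs) = Edge G a v × WalkFrom v vs

  WalkFrom-snoc : ∀ {a c b} l → WalkFrom a (l ++ c ∷ []) → Edge G c b →
                  WalkFrom a ((l ++ c ∷ []) ++ b ∷ [])
  WalkFrom-snoc []      (a~c , _)    c~b = a~c , c~b , tt
  WalkFrom-snoc (_ ∷ l) (a~d , walk) c~b = a~d , WalkFrom-snoc l walk c~b

  Cycle : List (Fin n) → Set
  Cycle []      = ⊥
  Cycle (h ∷ t) = 3 ≤ length (h ∷ t) × Unique (h ∷ t) × WalkFrom h (t ++ h ∷ [])

  closedWalk⇒walk : ∀ f h t → ClosedWalkFrom G f (h ∷ t) → WalkFrom h (t ++ f ∷ [])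
  closedWalk⇒walk f h []       h~f          = h~f , tt
  closedWalk⇒walk f h (h' ∷ t) (h~h' , cw) = h~h' , closedWalk⇒walk f h' t cw

  IsCycle⇒Cycle : ∀ c → IsCycle G c → Cycle c
  IsCycle⇒Cycle (h ∷ t) (len , uniq , cw) = len , uniq , closedWalk⇒walk h h t cw

  Cycle-rotate₁ : ∀ y t → Cycle (y ∷ t) → Cycle (t ++ y ∷ [])
  Cycle-rotate₁ y []      c                        = c
  Cycle-rotate₁ y (h ∷ t) (len , uniq , y~h , walk) =
    ≤-trans len (≤-reflexive (≡.sym (length-++-comm (h ∷ t) (y ∷ [])))) ,
    Unique-rotate₁ (h ∷ t) uniq ,
    WalkFrom-snoc t walk y~h

  Cycle-rotate : ∀ x ys zs → Cycle (ys ++ x ∷ zs) → ∃ λ zs' → Cycle (x ∷ zs')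
  Cycle-rotate x []       zs c = zs , c
  Cycle-rotate x (y ∷ ys) zs c =
    Cycle-rotate x ys (zs ++ y ∷ [])
      (subst Cycle (++-assoc ys (x ∷ zs) (y ∷ [])) (Cycle-rotate₁ y (ys ++ x ∷ zs) c))

  walkInto⇒ReachAvoiding : ∀ {x} a m → WalkFrom a (m ++ x ∷ []) → a ≢ x → All (x ≢_) m →
             ∃ λ b → b ∈ a ∷ m × ReachAvoiding G x a b × Edge G b x
  walkInto⇒ReachAvoiding a []      (a~x , _)    a≢x _           = a , here refl , here , a~x
  walkInto⇒ReachAvoiding a (c ∷ m) (a~c , walk) a≢x (x≢c ∷ x∉m)
    with b , b∈ , c⇝b , b~x ← walkInto⇒ReachAvoiding c m walk (≢-sym x≢c) x∉m =
    b , there b∈ , step a~c a≢x (≢-sym x≢c) c⇝b , b~x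

  onCycle⇒linkedNeighbours : ∀ {x} → OnCycle G x →
    ∃₂ λ a b → Edge G x a × Edge G x b × a ≢ b × ReachAvoiding G x a b
  onCycle⇒linkedNeighbours {x} (c , isCycle , x∈c)
    with ys , zs , refl ← ∈-∃++ x∈c
    with Cycle-rotate x ys zs (IsCycle⇒Cycle _ isCycle)
  ... | []            , s≤s () , _ , _
  ... | a ∷ []        , s≤s (s≤s ()) , _ , _
  ... | a ∷ c ∷ m , _ , (x≢a ∷ x≢c ∷ x∉m) ∷ (a∉cm ∷ _) , x~a , a~c , walk
    with b , b∈ , c⇝b , b~x ← walkInto⇒ReachAvoiding c m walk (≢-sym x≢c) x∉m =
    a , b , x~a , Graph.Edge-sym G b~x , All.lookup a∉cm b∈ , step a~c (≢-sym x≢a) (≢-sym x≢c) c⇝b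

BipartitionBy : ∀ {n} → SimpleGraph n → VSet n → Set
BipartitionBy G p = ∀ u v → Edge G u v ⇔ (p u ≢ p v)

bipartitionBy? : ∀ {n} (G : SimpleGraph n) p → Dec (BipartitionBy G p)
bipartitionBy? G p = all? λ u → all? λ v → Graph.edge? G u v ⇔-dec ¬? (p u ≟ᵇ p v)

SameNeighbourhood : ∀ {n} → SimpleGraph n → Fin n → Fin n → Set
SameNeighbourhood G x u = ∀ v → adj G u v ≡ adj G x v

module _ {n : ℕ} {G : SimpleGraph n} {x : Fin n} where

  open Graph G

  sameNeighbourhood-row : ∀ {u} → SameNeighbourhood G x u →
                          ∀ v → Edge G u v ⇔ (adj G x u ≢ adj G x v)
  sameNeighbourhood-row {u} same v rewrite same v | ≡.sym (same u) | irrefl G u = ≡true⇔false≢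

  sameNeighbourhoodOrNeighbour⇒BipartitionBy :
    (∀ {u v} → Edge G x u → Edge G x v → ¬ Edge G u v) →
    (∀ u → SameNeighbourhood G x u ⊎ Edge G x u) →
    BipartitionBy G (adj G x)
  sameNeighbourhoodOrNeighbour⇒BipartitionBy nonadjacent cover u v with cover u | cover v
  ... | inj₁ same-u | _         = sameNeighbourhood-row same-u v
  ... | inj₂ _      | inj₁ same-v =
    mk⇔ (λ u~v → ≢-sym (Equivalence.to row (Edge-sym u~v)))
        (λ differ → Edge-sym (Equivalence.from row (≢-sym differ)))
    where
    row : Edge G v u ⇔ (adj G x v ≢ adj G x u)
    row = sameNeighbourhood-row same-v u
  ... | inj₂ x~u    | inj₂ x~v  =
    mk⇔ (λ u~v → ⊥-elim (nonadjacent x~u x~v u~v))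
        (λ differ → ⊥-elim (differ (trans x~u (≡.sym x~v))))

module AllRobust {n : ℕ} {G : SimpleGraph n} (connected : Connected G)
                 (allRobust : ∀ S → MIS G S → Robust G S) where

  open Graph G
  open Greedy G using (Seed; seed⇒nonRobustMIS)

  ¬Seed : ∀ {x y I} → NoPendantNeighbour G x → (x~y : Edge G x y) → Seed x~y I → ⊥
  ¬Seed noPendant x~y seed
    with S , mis , ¬robust ← seed⇒nonRobustMIS x~y noPendant connected seed = ¬robust (allRobust S mis)

  neighbours-nonadjacent : ∀ {x y z} → NoPendantNeighbour G x →
                           Edge G x y → Edge G x z → ¬ Edge G y z
  neighbours-nonadjacent {x} {y} {z} noPendant x~y x~z y~z = ¬Seed noPendant x~y record
    { independent = singleton-independent G y
    ; y∈I         = insert-self _ y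
    ; reroutable  = λ {t} t∈ → case ∈-singleton⁻ {y = y} {v = t} t∈ of λ where
        refl → z , x~z , step y~z (≢-sym (Edge⇒≢ x~y)) (≢-sym (Edge⇒≢ x~z)) here ,
               y , insert-self _ y , Edge-sym y~z
    }

  linkedNeighbours-adjacent : ∀ {x a b z} → NoPendantNeighbour G x →
    Edge G x a → Edge G x b → ReachAvoiding G x a b → Edge G b z → z ≢ x → Edge G a z
  linkedNeighbours-adjacent {x} {a} {b} {z} noPendant x~a x~b a⇝b b~z z≢x with edge? a z
  ... | yes a~z = a~z
  ... | no  a≁z = ⊥-elim (¬Seed noPendant x~a record
    { independent = independent
    ; y∈I         = ⊆-insert (singleton a) z a (insert-self _ a)
    ; reroutable  = reroutable
    })
    where
    I : VSet n
    I = insert (singleton a) z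
    ∈I⁻ : ∀ v → v ∈ₛ I → v ≡ z ⊎ v ≡ a
    ∈I⁻ v v∈ with ∈-insert⁻ {S = singleton a} v∈
    ... | inj₁ v≡z = inj₁ v≡z
    ... | inj₂ v∈a = inj₂ (∈-singleton⁻ {v = v} v∈a)
    independent : Independent G I
    independent u v u∈ v∈ u~v with ∈I⁻ u u∈ | ∈I⁻ v v∈
    ... | inj₁ refl | inj₁ refl = Edge⇒≢ u~v refl
    ... | inj₂ refl | inj₂ refl = Edge⇒≢ u~v refl
    ... | inj₂ refl | inj₁ refl = a≁z u~v
    ... | inj₁ refl | inj₂ refl = a≁z (Edge-sym u~v)
    z∈I : z ∈ₛ I
    z∈I = insert-self (singleton a) z
    reroutable : ∀ {t} → t ∈ₛ I → Greedy.Reroutable G x~a I t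
    reroutable {t} t∈ with ∈I⁻ t t∈
    ... | inj₁ refl = b , x~b , step (Edge-sym b~z) z≢x (≢-sym (Edge⇒≢ x~b)) here , z , z∈I , b~z
    ... | inj₂ refl = b , x~b , a⇝b , z , z∈I , b~z

  module _ {x a b : Fin n} (noPendant : NoPendantNeighbour G x) (x~a : Edge G x a)
           (x~b : Edge G x b) (a≢b : a ≢ b) (a⇝b : ReachAvoiding G x a b) where

    noPendant-a : NoPendantNeighbour G a
    noPendant-a q a~q with q ≟ x
    ... | yes refl = b , x~b , ≢-sym a≢b
    ... | no  q≢x  =
      b , Edge-sym (linkedNeighbours-adjacent noPendant x~b x~a (ReachAvoiding-sym a⇝b) a~q q≢x) ,
      ≢-sym a≢b

    neighbourOf-a⇒sameNeighbourhood : ∀ {w} → Edge G a w → w ≢ x → SameNeighbourhood G x w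
    neighbourOf-a⇒sameNeighbourhood {w} a~w w≢x v with v ≟ a
    ... | yes refl = trans (Edge-sym a~w) (≡.sym x~a)
    ... | no  v≢a  = ⇔→≡ (mk⇔
      (λ w~v → linkedNeighbours-adjacent noPendant-a a~x a~w x⇝w w~v v≢a)
      (λ x~v → linkedNeighbours-adjacent noPendant-a a~w a~x (ReachAvoiding-sym x⇝w) x~v v≢a))
      where
      a~x : Edge G a x
      a~x = Edge-sym x~a
      b≢a : b ≢ a
      b≢a = ≢-sym a≢b
      b~w : Edge G b w
      b~w = linkedNeighbours-adjacent noPendant x~b x~a (ReachAvoiding-sym a⇝b) a~w w≢x
      x⇝w : ReachAvoiding G a x w
      x⇝w = step x~b (Edge⇒≢ x~a) b≢a (step b~w b≢a (≢-sym (Edge⇒≢ a~w)) here)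

    SameNeighbourhoodOrNeighbour : Fin n → Set
    SameNeighbourhoodOrNeighbour u = SameNeighbourhood G x u ⊎ Edge G x u

    sameNeighbourhoodOrNeighbour-step : ∀ {u v} → SameNeighbourhoodOrNeighbour u → Edge G u v →
                                        SameNeighbourhoodOrNeighbour v
    sameNeighbourhoodOrNeighbour-step {u} {v} (inj₁ same) u~v = inj₂ (trans (≡.sym (same v)) u~v)
    sameNeighbourhoodOrNeighbour-step {u} {v} (inj₂ x~u) u~v with v ≟ x
    ... | yes refl = inj₁ (λ _ → refl)
    ... | no  v≢x
      with w , a~w , w≢x ← noPendant a x~a =
      inj₁ (neighbourOf-a⇒sameNeighbourhood a~v v≢x)
      where
      w~u : Edge G w u
      w~u = trans (neighbourOf-a⇒sameNeighbourhood a~w w≢x u) x~u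
      a⇝u : ReachAvoiding G x a u
      a⇝u = step a~w (≢-sym (Edge⇒≢ x~a)) w≢x (step w~u w≢x (≢-sym (Edge⇒≢ x~u)) here)
      a~v : Edge G a v
      a~v = linkedNeighbours-adjacent noPendant x~a x~u a⇝u u~v v≢x

  onCycle⇒BipartitionBy : ∀ {x} → NoPendantNeighbour G x → OnCycle G x →
                          BipartitionBy G (adj G x)
  onCycle⇒BipartitionBy {x} noPendant onCycle
    with a , b , x~a , x~b , a≢b , a⇝b ← Cycles.onCycle⇒linkedNeighbours G onCycle =
    sameNeighbourhoodOrNeighbour⇒BipartitionBy {G = G} {x = x} (neighbours-nonadjacent noPendant)
      (λ u → Reach-preserves (sameNeighbourhoodOrNeighbour-step noPendant x~a x~b a≢b a⇝b)
                             (connected x u) (inj₁ (λ _ → refl)))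

module _ {n : ℕ} (G : SimpleGraph n) where

  open Graph G

  uniqueNeighbour⇒Pendant : ∀ {u x} → Edge G u x → (∀ z → Edge G u z → z ≡ x) → Pendant G u
  uniqueNeighbour⇒Pendant {u} {x} u~x unique =
    trans (cong sum (map-tabulate (λ w → w) indicator))
          (sum-tabulate-≡1 indicator x indicator-x indicator-0)
    where
    indicator : Fin n → ℕ
    indicator w = if adj G u w then 1 else 0
    indicator-x : indicator x ≡ 1
    indicator-x rewrite u~x = refl
    indicator-0 : ∀ w → w ≢ x → indicator w ≡ 0
    indicator-0 w w≢x with adj G u w in u~w
    ... | true  = ⊥-elim (w≢x (unique w u~w))
    ... | false = refl

  pendantNeighbour⊎noPendantNeighbour : ∀ x →
    (∃ λ u → Edge G x u × Pendant G u) ⊎ NoPendantNeighbour G x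
  pendantNeighbour⊎noPendantNeighbour x
    with any? (λ u → edge? x u ×-dec (degree G u ℕ.≟ 1))
  ... | yes pendant  = inj₁ pendant
  ... | no  ¬pendant = inj₂ otherNeighbour
    where
    otherNeighbour : NoPendantNeighbour G x
    otherNeighbour u x~u with any? (λ z → edge? u z ×-dec ¬? (z ≟ x))
    ... | yes other  = other
    ... | no  ¬other = ⊥-elim (¬pendant (u , x~u , uniqueNeighbour⇒Pendant (Edge-sym x~u) onlyX))
      where
      onlyX : ∀ z → Edge G u z → z ≡ x
      onlyX z u~z = decidable-stable (z ≟ x) (λ z≢x → ¬other (z , u~z , z≢x))

lemma3 : (n : ℕ) (G : SimpleGraph n) → Connected G → ¬ Sputnik G →
         (∀ S → MIS G S → Robust G S) → CompleteBipartite G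
-- ¬ Sputnik G yields no vertex constructively, so decide instead whether some
-- neighbourhood already is one side of a bipartition.
lemma3 n G connected ¬sputnik allRobust with any? (λ x → bipartitionBy? G (adj G x))
... | yes (x , bipartition) = adj G x , bipartition
... | no  ¬bipartition      = ⊥-elim (¬sputnik sputnik)
  where
  sputnik : Sputnik G
  sputnik v onCycle with pendantNeighbour⊎noPendantNeighbour G v
  ... | inj₁ pendant   = pendant
  ... | inj₂ noPendant =
    ⊥-elim (¬bipartition (v , AllRobust.onCycle⇒BipartitionBy connected allRobust noPendant onCycle))
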